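{- For every $\delta > 0$ there exists a bit-prediction strategy $\mathcal{P} = \mathcal{P}_{\delta}$ such that \[ \mathrm{Succ}^{\text{bit-pred}}(\mathcal{P}, A_{\mathrm{ws}} \cup A_{\mathrm{co\text{ - }ws}}) > 1 - \delta. \] Moreover, for every $x \in \{0,1\}^{\omega}$, the probability that $\mathcal{P}$ outputs an incorrect bit-prediction on $x$, namely $\sum_{i \in \mathbb{N}} \pi_{\mathcal{P},x}((i, 1 - x_i))$, is at most $\delta$.
   Context: Let $\mathbb{N} = \{1,2,\ldots\}$. A bit-prediction strategy is a collection $\mathcal{S} = \{\pi_{\mathcal{S},b} : b \in \{0,1\}^{\omega}\}$, where each $\pi_{\mathcal{S},b}$ is a probability distribution on $(\mathbb{N} \times \{0,1\}) \cup \{\infty\}$, such that for all $b, b'$, all $i \in \mathbb{N}$ and $z \in \{0,1\}$, if $(b_1,\ldots,b_{i-1}) = (b'_1,\ldots,b'_{i-1})$ then $\pi_{\mathcal{S},b}((i,z)) = \pi_{\mathcal{S},b'}((i,z))$. The outcome $(i,z)$ means ``predict $b_i = z$'', and $\infty$ means no prediction. Define $\mathrm{Succ}^{\text{bit-pred}}(\mathcal{S}, b) := \sum_{i} \pi_{\mathcal{S},b}((i,b_i))$ and $\mathrm{Succ}^{\text{bit-pred}}(\mathcal{S}, A) := \inf_{b\in A}\mathrm{Succ}^{\text{bit-pred}}(\mathcal{S}, b)$. A sequence $b$ is weakly sparse if $\lim_{s\to\infty}\left(\inf_{t\ge s} (b_1+\cdots+b_t)/t\right) = 0$. $A_{\mathrm{ws}}$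 denotes the set of weakly sparse sequences. $A_{\mathrm{co\text{ - }ws}} := \{x : \neg x \in A_{\mathrm{ws}}\}$, where $\neg x := (1-x_1, 1-x_2, \ldots)$.
   Formalization: The parameter δ ranges over the positive rationals, and the probabilities $\pi_{\mathcal{P},x}$ of the strategy take values in the rationals. -}

module Defs where

open import Data.Bool using (Bool; true; false; not)
open import Data.Nat as ℕ using (ℕ; zero; suc)
open import Data.Integer using (+_)
open import Data.Rational using (ℚ; 0ℚ; 1ℚ; _+_; _-_; _*_; _/_; _<_; _≤_)
open import Data.Product using (Σ; ∃; ∃-syntax; _×_)
open import Data.Sum using (_⊎_)
open import Relation.Binary.PropositionalEquality using (_≡_)

-- Infinite bit sequences b ∈ {0,1}^ω, 0-indexed: b i is the paper's b_{i+1}.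
-- false = 0, true = 1.
Seq : Set
Seq = ℕ → Bool

neg : Seq → Seq
neg x i = not (x i)

sumℚ : ℕ → (ℕ → ℚ) → ℚ
sumℚ zero    f = 0ℚ
sumℚ (suc n) f = sumℚ n f + f n

ones : Seq → ℕ → ℕ
ones b zero = zero
ones b (suc t) with b t
... | true  = suc (ones b t)
... | false = ones b t

-- (b_1 + ... + b_t)/t for t = suc k ≥ 1
density : Seq → ℕ → ℚ
density b k = (+ ones b (suc k)) / suc k

-- Weakly sparse: lim_{s→∞} inf_{t≥s} density_t = 0, written out:
-- ∀ε>0 ∃s₀ ∀s≥s₀, inf_{t≥s} density_t < ε  (inf ≥ 0, and inf < ε iff some t ≥ s has density_t < ε).
WeaklySparse : Seq → Set
WeaklySparse b =
  ∀ (ε : ℚ) → 0ℚ < ε →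
  ∃[ s₀ ] ∀ (s : ℕ) → s₀ ℕ.≤ s → ∃[ k ] (s ℕ.≤ suc k × density b k < ε)

A-ws : Seq → Set
A-ws = WeaklySparse

A-co-ws : Seq → Set
A-co-ws x = WeaklySparse (neg x)

-- A bit-prediction strategy.  prob b i z = π_{S,b}((i+1, z)); the remaining mass
-- (1 minus the total) is π_{S,b}(∞).  Probabilities are rational.
record Strategy : Set where
  field
    prob      : Seq → ℕ → Bool → ℚ
    nonneg    : ∀ b i z → 0ℚ ≤ prob b i z
    total≤1   : ∀ b N → sumℚ N (λ i → prob b i false + prob b i true) ≤ 1ℚ
    causal    : ∀ b b' i z → (∀ j → j ℕ.< i → b j ≡ b' j) → prob b i z ≡ prob b' i z
open Strategy public

succPartial : Strategy → Seq → ℕ → ℚ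
succPartial S b N = sumℚ N (λ i → prob S b i (b i))

errPartial : Strategy → Seq → ℕ → ℚ
errPartial S x N = sumℚ N (λ i → prob S x i (not (x i)))

-- Succ^{bit-pred}(S, A) > c, i.e. inf_{b∈A} Σ_i π_{S,b}((i,b_i)) > c, written out:
-- there is η > 0 such that every b ∈ A has Σ_i π_{S,b}((i,b_i)) ≥ c + η.
SuccGreater : Strategy → (Seq → Set) → ℚ → Set
SuccGreater S A c =
  ∃[ η ] (0ℚ < η × (∀ b → A b → ∃[ N ] (c + η ≤ succPartial S b N)))

ErrorAtMost : Strategy → Seq → ℚ → Set
ErrorAtMost S x d = ∀ N → errPartial S x N ≤ d

module Submission where

-- The strategy guesses the majority bit of the prefix seen so far and stakes half of
-- min(unspent mass, error budget) on it, where the error budget is d(1 + mass staked)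
-- minus the error already made.  The budget stays positive, so the total error is below 2d.
-- Each correct guess divides unspent/budget by q = 1 + d/2 and each mistake at most
-- doubles it; since budget ≤ 2d, the unspent mass is at most 2·2^misses / q^hits.
-- Majority voting makes at most 2m + 1 mistakes, m the number of minority bits, so at the
-- times where a (co-)weakly sparse sequence has small minority density the hits outnumber
-- the mistakes by any prescribed factor, the unspent mass is negligible, and almost all of
-- the mass has gone into correct predictions.

open import Defs
open import Data.Rational using (ℚ; 0ℚ; 1ℚ; _-_; _<_)
open import Data.Product using (Σ-syntax; _×_)
open import Data.Sum using (_⊎_)

open import Algebra.Bundles using (CommutativeRing; CommutativeMonoid)
open import Data.Bool using (Bool; true; false; _xor_; if_then_else_; T)
open import Data.Empty using (⊥-elim)
open import Data.Integer as ℤ using (+_; +[1+_]; -[1+_])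
import Data.Integer.Properties as ℤ
open import Data.Nat as ℕ using (ℕ; zero; suc)
import Data.Nat.Properties as ℕ
open import Data.Nat.Coprimality using (1-coprimeTo) renaming (sym to coprime-sym)
open import Data.Nat.Tactic.RingSolver using (solve-∀)
open import Data.Product using (_,_; ∃-syntax)
open import Data.Rational hiding (neg)
open import Data.Rational.Properties
open import Data.Rational.Solver using (module +-*-Solver)
import Data.Rational.Unnormalised as ℚᵘ
import Data.Rational.Unnormalised.Properties as ℚᵘ
open import Data.Sum using (inj₁; inj₂)
open import Relation.Binary.PropositionalEquality
  using (_≡_; refl; sym; trans; cong; cong₂; subst; subst₂; module ≡-Reasoning)

open import Algebra.Properties.Semiring.Exp (CommutativeRing.semiring +-*-commutativeRing)
  using (_^_; ^-homo-*; ^-assocʳ)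
open import Algebra.Properties.CommutativeSemigroup
  (CommutativeMonoid.commutativeSemigroup *-1-commutativeMonoid) using (xy∙z≈xz∙y)
open +-*-Solver using (solve; _:=_; con; _:+_; _:*_; _:-_)

≤-via-gap : ∀ {p q} r → p + r ≡ q → 0ℚ ≤ r → p ≤ q
≤-via-gap {p} {q} r p+r≡q 0≤r = begin
  p       ≡⟨ +-identityʳ p ⟨
  p + 0ℚ  ≤⟨ +-monoʳ-≤ p 0≤r ⟩
  p + r   ≡⟨ p+r≡q ⟩
  q       ∎
  where open ≤-Reasoning

0≤q-p : ∀ {p q} → p ≤ q → 0ℚ ≤ q - p
0≤q-p {p} {q} p≤q = subst (_≤ q - p) (+-inverseʳ p) (+-monoˡ-≤ (- p) p≤q)

+-nonNeg : ∀ {p q} → 0ℚ ≤ p → 0ℚ ≤ q → 0ℚ ≤ p + q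
+-nonNeg {p} {q} 0≤p 0≤q =
  nonNegative⁻¹ (p + q) {{nonNeg+nonNeg⇒nonNeg p {{nonNegative 0≤p}} q {{nonNegative 0≤q}}}}

pos+nonNeg : ∀ {p q} → 0ℚ < p → 0ℚ ≤ q → 0ℚ < p + q
pos+nonNeg {p} {q} 0<p 0≤q =
  positive⁻¹ (p + q) {{pos+nonNeg⇒pos p {{positive 0<p}} q {{nonNegative 0≤q}}}}

*-nonNeg : ∀ {p q} → 0ℚ ≤ p → 0ℚ ≤ q → 0ℚ ≤ p * q
*-nonNeg {p} {q} 0≤p 0≤q =
  nonNegative⁻¹ (p * q) {{nonNeg*nonNeg⇒nonNeg p {{nonNegative 0≤p}} q {{nonNegative 0≤q}}}}

*-pos : ∀ {p q} → 0ℚ < p → 0ℚ < q → 0ℚ < p * q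
*-pos {p} {q} 0<p 0<q = positive⁻¹ (p * q) {{pos*pos⇒pos p {{positive 0<p}} q {{positive 0<q}}}}

*-monoˡ-≤ : ∀ {p q} r → 0ℚ ≤ r → p ≤ q → r * p ≤ r * q
*-monoˡ-≤ r 0≤r = *-monoˡ-≤-nonNeg r {{nonNegative 0≤r}}

*-monoʳ-≤ : ∀ {p q} r → 0ℚ ≤ r → p ≤ q → p * r ≤ q * r
*-monoʳ-≤ r 0≤r = *-monoʳ-≤-nonNeg r {{nonNegative 0≤r}}

*-cancelʳ-≤ : ∀ {p q} r → 0ℚ < r → p * r ≤ q * r → p ≤ q
*-cancelʳ-≤ r 0<r = *-cancelʳ-≤-pos r {{positive 0<r}}

cross-≤-trans : ∀ {p₁ q₁ p₂ q₂ p₃ q₃} → 0ℚ < q₂ → 0ℚ ≤ q₁ → 0ℚ ≤ q₃ →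
                p₁ * q₂ ≤ p₂ * q₁ → p₂ * q₃ ≤ p₃ * q₂ → p₁ * q₃ ≤ p₃ * q₁
cross-≤-trans {p₁} {q₁} {p₂} {q₂} {p₃} {q₃} 0<q₂ 0≤q₁ 0≤q₃ p₁q₂≤p₂q₁ p₂q₃≤p₃q₂ =
  *-cancelʳ-≤ q₂ 0<q₂ (begin
    p₁ * q₃ * q₂  ≡⟨ xy∙z≈xz∙y p₁ q₃ q₂ ⟩
    p₁ * q₂ * q₃  ≤⟨ *-monoʳ-≤ q₃ 0≤q₃ p₁q₂≤p₂q₁ ⟩
    p₂ * q₁ * q₃  ≡⟨ xy∙z≈xz∙y p₂ q₁ q₃ ⟩
    p₂ * q₃ * q₁  ≤⟨ *-monoʳ-≤ q₁ 0≤q₁ p₂q₃≤p₃q₂ ⟩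
    p₃ * q₂ * q₁  ≡⟨ xy∙z≈xz∙y p₃ q₂ q₁ ⟩
    p₃ * q₁ * q₂  ∎)
  where open ≤-Reasoning

0<½ : 0ℚ < ½
0<½ = *<* (ℤ.+<+ (ℕ.s≤s ℕ.z≤n))

0<1 : 0ℚ < 1ℚ
0<1 = *<* (ℤ.+<+ (ℕ.s≤s ℕ.z≤n))

0≤1 : 0ℚ ≤ 1ℚ
0≤1 = <⇒≤ 0<1

2ℚ : ℚ
2ℚ = 1ℚ + 1ℚ

0<2 : 0ℚ < 2ℚ
0<2 = *<* (ℤ.+<+ (ℕ.s≤s ℕ.z≤n))

^-nonNeg : ∀ {p} n → 0ℚ ≤ p → 0ℚ ≤ p ^ n
^-nonNeg zero    0≤p = 0≤1
^-nonNeg (suc n) 0≤p = *-nonNeg 0≤p (^-nonNeg n 0≤p)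

^-pos : ∀ {p} n → 0ℚ < p → 0ℚ < p ^ n
^-pos zero    0<p = 0<1
^-pos (suc n) 0<p = *-pos 0<p (^-pos n 0<p)

^-monoˡ-≤ : ∀ {p q} n → 0ℚ ≤ p → p ≤ q → p ^ n ≤ q ^ n
^-monoˡ-≤ zero    0≤p p≤q = ≤-refl
^-monoˡ-≤ {p} {q} (suc n) 0≤p p≤q = begin
  p * p ^ n  ≤⟨ *-monoʳ-≤ (p ^ n) (^-nonNeg n 0≤p) p≤q ⟩
  q * p ^ n  ≤⟨ *-monoˡ-≤ q (≤-trans 0≤p p≤q) (^-monoˡ-≤ n 0≤p p≤q) ⟩
  q * q ^ n  ∎
  where open ≤-Reasoning

1≤^ : ∀ {p} n → 1ℚ ≤ p → 1ℚ ≤ p ^ n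
1≤^ zero    1≤p = ≤-refl
1≤^ {p} (suc n) 1≤p = begin
  1ℚ         ≤⟨ 1≤p ⟩
  p          ≡⟨ *-identityʳ p ⟨
  p * 1ℚ     ≤⟨ *-monoˡ-≤ p (≤-trans 0≤1 1≤p) (1≤^ n 1≤p) ⟩
  p * p ^ n  ∎
  where open ≤-Reasoning

^-monoʳ-≤ : ∀ {p} → 1ℚ ≤ p → ∀ {m n} → m ℕ.≤ n → p ^ m ≤ p ^ n
^-monoʳ-≤ {p} 1≤p {m} {n} m≤n = begin
  p ^ m                  ≡⟨ *-identityʳ (p ^ m) ⟨
  p ^ m * 1ℚ             ≤⟨ *-monoˡ-≤ (p ^ m) (^-nonNeg m (≤-trans 0≤1 1≤p)) (1≤^ (n ℕ.∸ m) 1≤p) ⟩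
  p ^ m * p ^ (n ℕ.∸ m)  ≡⟨ ^-homo-* p m (n ℕ.∸ m) ⟨
  p ^ (m ℕ.+ (n ℕ.∸ m))  ≡⟨ cong (p ^_) (ℕ.m+[n∸m]≡n m≤n) ⟩
  p ^ n                  ∎
  where open ≤-Reasoning

fromℕ : ℕ → ℚ
fromℕ n = mkℚ (+ n) 0 (coprime-sym (1-coprimeTo n))

fromℕ-nonNeg : ∀ n → 0ℚ ≤ fromℕ n
fromℕ-nonNeg n = *≤* (subst (ℤ._≤_ (+ 0)) (sym (ℤ.*-identityʳ (+ n))) (ℤ.+≤+ ℕ.z≤n))

fromℕ-suc : ∀ n → fromℕ (suc n) ≡ 1ℚ + fromℕ n
fromℕ-suc n = toℚᵘ-injective (ℚᵘ.≃-sym (ℚᵘ.≃-trans (toℚᵘ-homo-+ 1ℚ (fromℕ n)) (ℚᵘ.*≡* cross)))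
  where
  cross : (+ 1 ℤ.* + 1 ℤ.+ + n ℤ.* + 1) ℤ.* + 1 ≡ + suc n ℤ.* (+ 1 ℤ.* + 1)
  cross = trans (ℤ.*-identityʳ _)
    (trans (cong (ℤ._+_ (+ 1)) (ℤ.*-identityʳ (+ n))) (sym (ℤ.*-identityʳ (+ suc n))))

fromℕ-+ : ∀ m n → fromℕ (m ℕ.+ n) ≡ fromℕ m + fromℕ n
fromℕ-+ zero    n = sym (+-identityˡ (fromℕ n))
fromℕ-+ (suc m) n = begin
  fromℕ (suc (m ℕ.+ n))     ≡⟨ fromℕ-suc (m ℕ.+ n) ⟩
  1ℚ + fromℕ (m ℕ.+ n)      ≡⟨ cong (λ x → 1ℚ + x) (fromℕ-+ m n) ⟩
  1ℚ + (fromℕ m + fromℕ n)  ≡⟨ +-assoc 1ℚ (fromℕ m) (fromℕ n) ⟨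
  1ℚ + fromℕ m + fromℕ n    ≡⟨ cong (_+ fromℕ n) (fromℕ-suc m) ⟨
  fromℕ (suc m) + fromℕ n   ∎
  where open ≡-Reasoning

fromℕ-* : ∀ m n → fromℕ (m ℕ.* n) ≡ fromℕ m * fromℕ n
fromℕ-* zero    n = sym (*-zeroˡ (fromℕ n))
fromℕ-* (suc m) n = begin
  fromℕ (n ℕ.+ m ℕ.* n)        ≡⟨ fromℕ-+ n (m ℕ.* n) ⟩
  fromℕ n + fromℕ (m ℕ.* n)    ≡⟨ cong (λ x → fromℕ n + x) (fromℕ-* m n) ⟩
  fromℕ n + fromℕ m * fromℕ n  ≡⟨ solve 2 (λ x y → y :+ x :* y := (con 1ℚ :+ x) :* y)
                                         refl (fromℕ m) (fromℕ n) ⟩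
  (1ℚ + fromℕ m) * fromℕ n     ≡⟨ cong (_* fromℕ n) (fromℕ-suc m) ⟨
  fromℕ (suc m) * fromℕ n      ∎
  where open ≡-Reasoning

bernoulli : ∀ {h} n → 0ℚ ≤ h → 1ℚ + fromℕ n * h ≤ (1ℚ + h) ^ n
bernoulli {h} zero 0≤h = ≤-reflexive (trans (cong (λ x → 1ℚ + x) (*-zeroˡ h)) (+-identityʳ 1ℚ))
bernoulli {h} (suc n) 0≤h = begin
  1ℚ + fromℕ (suc n) * h         ≤⟨ ≤-via-gap (fromℕ n * h * h) expand
                                        (*-nonNeg (*-nonNeg (fromℕ-nonNeg n) 0≤h) 0≤h) ⟩
  (1ℚ + h) * (1ℚ + fromℕ n * h)  ≤⟨ *-monoˡ-≤ (1ℚ + h) (+-nonNeg 0≤1 0≤h) (bernoulli n 0≤h) ⟩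
  (1ℚ + h) * (1ℚ + h) ^ n        ∎
  where
  open ≤-Reasoning
  expand : 1ℚ + fromℕ (suc n) * h + fromℕ n * h * h ≡ (1ℚ + h) * (1ℚ + fromℕ n * h)
  expand = trans (cong (λ x → 1ℚ + x * h + fromℕ n * h * h) (fromℕ-suc n))
    (solve 2 (λ x h → con 1ℚ :+ (con 1ℚ :+ x) :* h :+ x :* h :* h := (con 1ℚ :+ h) :* (con 1ℚ :+ x :* h))
           refl (fromℕ n) h)

1≤↧*p : ∀ {p} → 0ℚ < p → 1ℚ ≤ fromℕ (↧ₙ p) * p
1≤↧*p {p@(mkℚ +[1+ k ] m _)} _ =
  toℚᵘ-cancel-≤ (ℚᵘ.≤-respʳ-≃ (ℚᵘ.≃-sym (toℚᵘ-homo-* (fromℕ (suc m)) p)) (ℚᵘ.*≤* numerator≥1))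
  where
  numerator≥1 : + 1 ℤ.* (+ 1 ℤ.* + suc m) ℤ.≤ (+ suc m ℤ.* +[1+ k ]) ℤ.* + 1
  numerator≥1 = subst₂ ℤ._≤_ (sym (trans (ℤ.*-identityˡ _) (ℤ.*-identityˡ _))) (sym (ℤ.*-identityʳ _))
    (ℤ.+≤+ (ℕ.m≤m*n (suc m) (suc k)))
1≤↧*p {mkℚ (+ 0)    _ _} (*<* 0<0) = ⊥-elim (ℤ.<-irrefl refl 0<0)
1≤↧*p {mkℚ -[1+ _ ] _ _} (*<* ())

density<1/ : ∀ o k n .{{_ : ℕ.NonZero n}} → + o / suc k < 1/ fromℕ n → o ℕ.* n ℕ.< suc k
density<1/ o k (suc n) o/k<1/n
  with ℚᵘ.*<* o*n<k ← ℚᵘ.<-respˡ-≃ (toℚᵘ-fromℚᵘ (ℚᵘ.mkℚᵘ (+ o) k)) (toℚᵘ-mono-< o/k<1/n) =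
  ℤ.drop‿+<+ (subst₂ ℤ._<_ (sym (ℤ.pos-* o (suc n))) (ℤ.*-identityˡ _) o*n<k)

AgreeBelow : ℕ → Seq → Seq → Set
AgreeBelow t b b′ = ∀ j → j ℕ.< t → b j ≡ b′ j

agreeBelow-pred : ∀ {t b b′} → AgreeBelow (suc t) b b′ → AgreeBelow t b b′
agreeBelow-pred agree j j<t = agree j (ℕ.m≤n⇒m≤1+n j<t)

ones-cong : ∀ {b b′} t → AgreeBelow t b b′ → ones b t ≡ ones b′ t
ones-cong zero    _     = refl
ones-cong {b} {b′} (suc t) agree
  with b t | b′ t | agree t ℕ.≤-refl | ones-cong t (agreeBelow-pred agree)
... | true  | .true  | refl | eq = cong suc eq
... | false | .false | refl | eq = eq

ones≤ : ∀ b t → ones b t ℕ.≤ t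
ones≤ b zero = ℕ.z≤n
ones≤ b (suc t) with b t
... | true  = ℕ.s≤s (ones≤ b t)
... | false = ℕ.m≤n⇒m≤1+n (ones≤ b t)

ones+ones-neg : ∀ b t → ones b t ℕ.+ ones (neg b) t ≡ t
ones+ones-neg b zero = refl
ones+ones-neg b (suc t) with b t
... | true  = cong suc (ones+ones-neg b t)
... | false = trans (ℕ.+-suc (ones b t) (ones (neg b) t)) (cong suc (ones+ones-neg b t))

-- Majority vote over the prefix; a tie predicts 0.
guess : Seq → ℕ → Bool
guess b i = i ℕ.<ᵇ 2 ℕ.* ones b i

guess-cong : ∀ {b b′} t → AgreeBelow t b b′ → guess b t ≡ guess b′ t
guess-cong t agree = cong (λ o → t ℕ.<ᵇ 2 ℕ.* o) (ones-cong t agree)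

mistake : Seq → Seq
mistake b i = b i xor guess b i

misses hits : Seq → ℕ → ℕ
misses b = ones (mistake b)
hits   b = ones (neg (mistake b))

misses+hits : ∀ b t → misses b t ℕ.+ hits b t ≡ t
misses+hits b = ones+ones-neg (mistake b)

private
  2o+1≤2[1+o]+1 : ∀ {W o} → W ℕ.≤ 2 ℕ.* o ℕ.+ 1 → W ℕ.≤ 2 ℕ.* suc o ℕ.+ 1
  2o+1≤2[1+o]+1 {W} {o} W≤ = ℕ.≤-trans W≤ (ℕ.+-monoˡ-≤ 1 (ℕ.*-monoʳ-≤ 2 (ℕ.n≤1+n o)))

  1+[2o+1]≤2[1+o]+1 : ∀ {W o} → W ℕ.≤ 2 ℕ.* o ℕ.+ 1 → suc W ℕ.≤ 2 ℕ.* suc o ℕ.+ 1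
  1+[2o+1]≤2[1+o]+1 {W} {o} W≤ = ℕ.≤-trans (ℕ.s≤s W≤) (ℕ.≤-trans (ℕ.n≤1+n _) (ℕ.≤-reflexive (expand o)))
    where
    expand : ∀ o → 1 ℕ.+ suc (2 ℕ.* o ℕ.+ 1) ≡ 2 ℕ.* suc o ℕ.+ 1
    expand = solve-∀

misses≤2*ones+1 : ∀ b t → misses b t ℕ.≤ 2 ℕ.* ones b t ℕ.+ 1
misses≤2*ones+1 b zero = ℕ.z≤n
misses≤2*ones+1 b (suc t) with b t | guess b t in guess≡
... | true  | true  = 2o+1≤2[1+o]+1 (misses≤2*ones+1 b t)
... | true  | false = 1+[2o+1]≤2[1+o]+1 (misses≤2*ones+1 b t)
... | false | false = misses≤2*ones+1 b t
... | false | true  = ℕ.≤-trans (ℕ.s≤s (ones≤ (mistake b) t)) (ℕ.≤-trans t<2o (ℕ.m≤m+n _ 1))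
  where
  t<2o : t ℕ.< 2 ℕ.* ones b t
  t<2o = ℕ.<ᵇ⇒< t _ (subst T (sym guess≡) _)

misses≤2*zeros+1 : ∀ b t → misses b t ℕ.≤ 2 ℕ.* ones (neg b) t ℕ.+ 1
misses≤2*zeros+1 b zero = ℕ.z≤n
misses≤2*zeros+1 b (suc t) with b t | guess b t in guess≡ | ones+ones-neg b t
... | true  | true  | _ = misses≤2*zeros+1 b t
... | false | true  | _ = 1+[2o+1]≤2[1+o]+1 (misses≤2*zeros+1 b t)
... | false | false | _ = 2o+1≤2[1+o]+1 (misses≤2*zeros+1 b t)
... | true  | false | o+z≡t =
  ℕ.≤-trans (ℕ.s≤s (ℕ.≤-trans (ones≤ (mistake b) t) t≤2z)) (ℕ.≤-reflexive (ℕ.+-comm 1 _))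
  where
  o = ones b t
  z = ones (neg b) t
  2o≤t : 2 ℕ.* o ℕ.≤ t
  2o≤t = ℕ.≮⇒≥ (λ t<2o → subst T guess≡ (ℕ.<⇒<ᵇ t<2o))
  o≤z : o ℕ.≤ z
  o≤z = ℕ.+-cancelˡ-≤ o o z (subst₂ ℕ._≤_ (cong (o ℕ.+_) (ℕ.+-identityʳ o)) (sym o+z≡t) 2o≤t)
  t≤2z : t ℕ.≤ 2 ℕ.* z
  t≤2z = subst₂ ℕ._≤_ o+z≡t (cong (z ℕ.+_) (sym (ℕ.+-identityʳ z))) (ℕ.+-monoˡ-≤ z o≤z)

weighted-count : ∀ A B o W t → W ℕ.≤ 2 ℕ.* o ℕ.+ 1 → o ℕ.* (4 ℕ.* A) ℕ.< t →
                 2 ℕ.* (A ℕ.+ B) ℕ.≤ t → A ℕ.* W ℕ.+ B ℕ.≤ t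
weighted-count A B o W t W≤ o*4A<t 2[A+B]≤t = ℕ.*-cancelˡ-≤ 2 (begin
  2 ℕ.* (A ℕ.* W ℕ.+ B)                ≤⟨ ℕ.*-monoʳ-≤ 2 (ℕ.+-monoˡ-≤ B (ℕ.*-monoʳ-≤ A W≤)) ⟩
  2 ℕ.* (A ℕ.* (2 ℕ.* o ℕ.+ 1) ℕ.+ B)  ≡⟨ regroup A B o ⟩
  o ℕ.* (4 ℕ.* A) ℕ.+ 2 ℕ.* (A ℕ.+ B)  ≤⟨ ℕ.+-mono-≤ (ℕ.<⇒≤ o*4A<t) 2[A+B]≤t ⟩
  t ℕ.+ t                              ≡⟨ cong (t ℕ.+_) (ℕ.+-identityʳ t) ⟨
  2 ℕ.* t                              ∎)
  where
  open ℕ.≤-Reasoning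
  regroup : ∀ A B o → 2 ℕ.* (A ℕ.* (2 ℕ.* o ℕ.+ 1) ℕ.+ B) ≡ o ℕ.* (4 ℕ.* A) ℕ.+ 2 ℕ.* (A ℕ.+ B)
  regroup = solve-∀

hits-dominate : ∀ M R o b t → misses b t ℕ.≤ 2 ℕ.* o ℕ.+ 1 → o ℕ.* (4 ℕ.* suc M) ℕ.< t →
                2 ℕ.* (suc M ℕ.+ R) ℕ.≤ t → M ℕ.* misses b t ℕ.+ R ℕ.≤ hits b t
hits-dominate M R o b t W≤ sparse long = ℕ.+-cancelˡ-≤ W _ _ (begin
  W ℕ.+ (M ℕ.* W ℕ.+ R)  ≡⟨ ℕ.+-assoc W (M ℕ.* W) R ⟨
  suc M ℕ.* W ℕ.+ R      ≤⟨ weighted-count (suc M) R o W t W≤ sparse long ⟩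
  t                      ≡⟨ misses+hits b t ⟨
  W ℕ.+ hits b t         ∎)
  where
  open ℕ.≤-Reasoning
  W = misses b t

record Ledger : Set where
  constructor ⟨_,_⟩
  field
    wrong right : ℚ
open Ledger

module MajorityBetting (d : ℚ) (0<d : 0ℚ < d) (d≤1 : d ≤ 1ℚ) where

  0≤d : 0ℚ ≤ d
  0≤d = <⇒≤ 0<d

  q : ℚ
  q = 1ℚ + d * ½

  1≤q : 1ℚ ≤ q
  1≤q = ≤-via-gap (d * ½) refl (*-nonNeg 0≤d (<⇒≤ 0<½))

  0≤q : 0ℚ ≤ q
  0≤q = ≤-trans 0≤1 1≤q

  unspent budget stake : Ledger → ℚ
  unspent ℓ = 1ℚ - wrong ℓ - right ℓ
  budget  ℓ = d + d * (wrong ℓ + right ℓ) - wrong ℓ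
  stake   ℓ = (unspent ℓ ⊓ budget ℓ) * ½

  settle : Bool → Ledger → Ledger
  settle true  ℓ = record ℓ { wrong = wrong ℓ + stake ℓ }
  settle false ℓ = record ℓ { right = right ℓ + stake ℓ }

  ledger : Seq → ℕ → Ledger
  ledger b zero    = ⟨ 0ℚ , 0ℚ ⟩
  ledger b (suc i) = settle (mistake b i) (ledger b i)

  bet : Seq → ℕ → Bool → ℚ
  bet b i z = if z xor guess b i then 0ℚ else stake (ledger b i)

  unspent-settle : ∀ c ℓ → unspent (settle c ℓ) ≡ unspent ℓ - stake ℓ
  unspent-settle true  ℓ =
    solve 3 (λ w r a → con 1ℚ :- (w :+ a) :- r := con 1ℚ :- w :- r :- a) refl (wrong ℓ) (right ℓ) (stake ℓ)
  unspent-settle false ℓ =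
    solve 3 (λ w r a → con 1ℚ :- w :- (r :+ a) := con 1ℚ :- w :- r :- a) refl (wrong ℓ) (right ℓ) (stake ℓ)

  budget-hit : ∀ ℓ → budget (settle false ℓ) ≡ budget ℓ + d * stake ℓ
  budget-hit ℓ = solve 4 (λ w r a d → d :+ d :* (w :+ (r :+ a)) :- w := d :+ d :* (w :+ r) :- w :+ d :* a)
                         refl (wrong ℓ) (right ℓ) (stake ℓ) d

  budget-miss : ∀ ℓ → budget (settle true ℓ) ≡ budget ℓ - stake ℓ + d * stake ℓ
  budget-miss ℓ = solve 4 (λ w r a d → d :+ d :* ((w :+ a) :+ r) :- (w :+ a) := d :+ d :* (w :+ r) :- w :- a :+ d :* a)
                          refl (wrong ℓ) (right ℓ) (stake ℓ) d

  staked-settle : ∀ c ℓ → wrong (settle c ℓ) + right (settle c ℓ) ≡ wrong ℓ + right ℓ + stake ℓ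
  staked-settle true  ℓ = solve 3 (λ w r a → (w :+ a) :+ r := w :+ r :+ a) refl (wrong ℓ) (right ℓ) (stake ℓ)
  staked-settle false ℓ = sym (+-assoc (wrong ℓ) (right ℓ) (stake ℓ))

  record Solvent (ℓ : Ledger) : Set where
    field
      0≤wrong   : 0ℚ ≤ wrong ℓ
      0<unspent : 0ℚ < unspent ℓ
      0<budget  : 0ℚ < budget ℓ
  open Solvent

  Potential : ℕ → ℕ → Ledger → Set
  Potential C W ℓ = unspent ℓ * (d * q ^ C) ≤ 2ℚ ^ W * budget ℓ

  module _ {ℓ : Ledger} (sol : Solvent ℓ) where
    private
      S σ m a : ℚ
      S = unspent ℓ
      σ = budget ℓ
      m = S ⊓ σ
      a = stake ℓ
      0<S : 0ℚ < S
      0<S = 0<unspent sol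
      0<σ : 0ℚ < σ
      0<σ = 0<budget sol
      0<m : 0ℚ < m
      0<m with ⊓-sel S σ
      ... | inj₁ m≡S = subst (0ℚ <_) (sym m≡S) 0<S
      ... | inj₂ m≡σ = subst (0ℚ <_) (sym m≡σ) 0<σ

    0<stake : 0ℚ < a
    0<stake = *-pos 0<m 0<½

    0<unspent-stake : 0ℚ < S - a
    0<unspent-stake = subst (0ℚ <_) (solve 2 (λ S m → m :* con ½ :+ (S :- m) := S :- m :* con ½) refl S m)
      (pos+nonNeg 0<stake (0≤q-p (p⊓q≤p S σ)))

    0<budget-miss : 0ℚ < σ - a + d * a
    0<budget-miss = subst (0ℚ <_)
      (solve 3 (λ σ m d → m :* con ½ :+ ((σ :- m) :+ d :* (m :* con ½)) := σ :- m :* con ½ :+ d :* (m :* con ½))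
             refl σ m d)
      (pos+nonNeg 0<stake (+-nonNeg (0≤q-p (p⊓q≤q S σ)) (*-nonNeg 0≤d (<⇒≤ 0<stake))))

    0<budget-hit : 0ℚ < σ + d * a
    0<budget-hit = pos+nonNeg 0<σ (*-nonNeg 0≤d (<⇒≤ 0<stake))

    solvent-settle : ∀ c → Solvent (settle c ℓ)
    solvent-settle true = record
      { 0≤wrong   = +-nonNeg (0≤wrong sol) (<⇒≤ 0<stake)
      ; 0<unspent = subst (0ℚ <_) (sym (unspent-settle true ℓ)) 0<unspent-stake
      ; 0<budget  = subst (0ℚ <_) (sym (budget-miss ℓ)) 0<budget-miss
      }
    solvent-settle false = record
      { 0≤wrong   = 0≤wrong sol
      ; 0<unspent = subst (0ℚ <_) (sym (unspent-settle false ℓ)) 0<unspent-stake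
      ; 0<budget  = subst (0ℚ <_) (sym (budget-hit ℓ)) 0<budget-hit
      }

    -- ratio-hit needs the stake to be a fixed fraction of min(S, σ), ratio-miss needs it to be at most σ/2.
    ratio-hit : (S - a) * q * σ ≤ S * (σ + d * a)
    ratio-hit = ≤-via-gap _
      (solve 4 (λ S σ m d → (S :- m :* con ½) :* (con 1ℚ :+ d :* con ½) :* σ
                             :+ (con ½ :* (m :* (S :* d :+ σ) :- S :* σ :* d) :+ m :* con ½ :* σ :* d :* con ½)
                           := S :* (σ :+ d :* (m :* con ½)))
             refl S σ m d)
      (+-nonNeg (*-nonNeg (<⇒≤ 0<½) (0≤q-p Sσd≤m[Sd+σ]))
                (*-nonNeg (*-nonNeg (*-nonNeg (<⇒≤ 0<stake) (<⇒≤ 0<σ)) 0≤d) (<⇒≤ 0<½)))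
      where
      open ≤-Reasoning
      Sσd≤m[Sd+σ] : S * σ * d ≤ m * (S * d + σ)
      Sσd≤m[Sd+σ] with ⊓-sel S σ
      ... | inj₁ m≡S = begin
        S * σ * d        ≤⟨ *-monoˡ-≤ (S * σ) (*-nonNeg (<⇒≤ 0<S) (<⇒≤ 0<σ)) d≤1 ⟩
        S * σ * 1ℚ       ≡⟨ *-identityʳ (S * σ) ⟩
        S * σ            ≤⟨ *-monoˡ-≤ S (<⇒≤ 0<S)
                                (≤-via-gap (S * d) (+-comm σ (S * d)) (*-nonNeg (<⇒≤ 0<S) 0≤d)) ⟩
        S * (S * d + σ)  ≡⟨ cong (_* (S * d + σ)) m≡S ⟨
        m * (S * d + σ)  ∎
      ... | inj₂ m≡σ = begin
        S * σ * d        ≡⟨ solve 3 (λ S σ d → S :* σ :* d := σ :* (S :* d)) refl S σ d ⟩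
        σ * (S * d)      ≤⟨ *-monoˡ-≤ σ (<⇒≤ 0<σ) (≤-via-gap σ refl (<⇒≤ 0<σ)) ⟩
        σ * (S * d + σ)  ≡⟨ cong (_* (S * d + σ)) m≡σ ⟨
        m * (S * d + σ)  ∎

    ratio-miss : (S - a) * σ ≤ S * ((σ - a + d * a) * 2ℚ)
    ratio-miss = ≤-via-gap _
      (solve 4 (λ S σ m d → (S :- m :* con ½) :* σ :+ (S :* (σ :- m) :+ S :* d :* m :+ m :* con ½ :* σ)
                           := S :* ((σ :- m :* con ½ :+ d :* (m :* con ½)) :* (con 1ℚ :+ con 1ℚ)))
             refl S σ m d)
      (+-nonNeg (+-nonNeg (*-nonNeg (<⇒≤ 0<S) (0≤q-p (p⊓q≤q S σ)))
                          (*-nonNeg (*-nonNeg (<⇒≤ 0<S) 0≤d) (<⇒≤ 0<m)))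
                (*-nonNeg (<⇒≤ 0<stake) (<⇒≤ 0<σ)))

    potential-hit : ∀ {C W} → Potential C W ℓ → Potential (suc C) W (settle false ℓ)
    potential-hit {C} {W} pot = begin
      unspent (settle false ℓ) * (d * q ^ suc C)  ≡⟨ cong (_* (d * q ^ suc C)) (unspent-settle false ℓ) ⟩
      (S - a) * (d * (q * q ^ C))                 ≡⟨ solve 4 (λ x d q y → x :* (d :* (q :* y)) := x :* q :* (d :* y))
                                                           refl (S - a) d q (q ^ C) ⟩
      (S - a) * q * (d * q ^ C)                   ≤⟨ cross-≤-trans {(S - a) * q} {σ + d * a} {S} {σ}
                                                                       {2ℚ ^ W} {d * q ^ C}
                                                       0<σ (<⇒≤ 0<budget-hit) (*-nonNeg 0≤d (^-nonNeg C 0≤q))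
                                                       ratio-hit pot ⟩
      2ℚ ^ W * (σ + d * a)                        ≡⟨ cong (2ℚ ^ W *_) (budget-hit ℓ) ⟨
      2ℚ ^ W * budget (settle false ℓ)            ∎
      where open ≤-Reasoning

    potential-miss : ∀ {C W} → Potential C W ℓ → Potential C (suc W) (settle true ℓ)
    potential-miss {C} {W} pot = begin
      unspent (settle true ℓ) * (d * q ^ C)  ≡⟨ cong (_* (d * q ^ C)) (unspent-settle true ℓ) ⟩
      (S - a) * (d * q ^ C)                  ≤⟨ cross-≤-trans {S - a} {σ′ * 2ℚ} {S} {σ} {2ℚ ^ W} {d * q ^ C}
                                                  0<σ (*-nonNeg (<⇒≤ 0<budget-miss) (<⇒≤ 0<2))
                                                  (*-nonNeg 0≤d (^-nonNeg C 0≤q)) ratio-miss pot ⟩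
      2ℚ ^ W * (σ′ * 2ℚ)                     ≡⟨ solve 2 (λ x y → x :* (y :* con 2ℚ) := con 2ℚ :* x :* y) refl (2ℚ ^ W) σ′ ⟩
      2ℚ * 2ℚ ^ W * σ′                       ≡⟨ cong (2ℚ ^ suc W *_) (budget-miss ℓ) ⟨
      2ℚ ^ suc W * budget (settle true ℓ)    ∎
      where
      open ≤-Reasoning
      σ′ = σ - a + d * a

    staked≤1 : wrong ℓ + right ℓ ≤ 1ℚ
    staked≤1 = ≤-via-gap S (solve 2 (λ w r → w :+ r :+ (con 1ℚ :- w :- r) := con 1ℚ) refl (wrong ℓ) (right ℓ))
                         (<⇒≤ 0<S)

    allowance≤2d : d + d * (wrong ℓ + right ℓ) ≤ d + d
    allowance≤2d = +-monoʳ-≤ d (≤-trans (*-monoˡ-≤ d 0≤d staked≤1) (≤-reflexive (*-identityʳ d)))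

    wrong≤2d : wrong ℓ ≤ d + d
    wrong≤2d = ≤-trans (≤-via-gap σ (solve 3 (λ w r d → w :+ (d :+ d :* (w :+ r) :- w) := d :+ d :* (w :+ r))
                                            refl (wrong ℓ) (right ℓ) d)
                                  (<⇒≤ 0<σ))
                       allowance≤2d

    budget≤2d : σ ≤ d + d
    budget≤2d = ≤-trans (≤-via-gap (wrong ℓ) (solve 3 (λ w r d → d :+ d :* (w :+ r) :- w :+ w := d :+ d :* (w :+ r))
                                                    refl (wrong ℓ) (right ℓ) d)
                                   (0≤wrong sol))
                        allowance≤2d

  solvent : ∀ b t → Solvent (ledger b t)
  solvent b zero = record
    { 0≤wrong   = ≤-refl
    ; 0<unspent = subst (0ℚ <_) (solve 0 (con 1ℚ := con 1ℚ :- con 0ℚ :- con 0ℚ) refl) 0<1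
    ; 0<budget  = subst (0ℚ <_) (solve 1 (λ d → d := d :+ d :* (con 0ℚ :+ con 0ℚ) :- con 0ℚ) refl d) 0<d
    }
  solvent b (suc t) = solvent-settle (solvent b t) (mistake b t)

  potential : ∀ b t → Potential (hits b t) (misses b t) (ledger b t)
  potential b zero = ≤-reflexive
    (solve 1 (λ d → (con 1ℚ :- con 0ℚ :- con 0ℚ) :* (d :* con 1ℚ) := con 1ℚ :* (d :+ d :* (con 0ℚ :+ con 0ℚ) :- con 0ℚ))
           refl d)
  potential b (suc t) with mistake b t
  ... | true  = potential-miss (solvent b t) {hits b t} {misses b t} (potential b t)
  ... | false = potential-hit  (solvent b t) {hits b t} {misses b t} (potential b t)

  unspent*K≤2 : ∀ b t K → K * 2ℚ ^ misses b t ≤ q ^ hits b t → unspent (ledger b t) * K ≤ 2ℚ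
  unspent*K≤2 b t K K*2^W≤q^C = *-cancelʳ-≤ (2ℚ ^ W) (^-pos W 0<2) (begin
    U * K * 2ℚ ^ W    ≡⟨ *-assoc U K (2ℚ ^ W) ⟩
    U * (K * 2ℚ ^ W)  ≤⟨ *-monoˡ-≤ U (<⇒≤ (0<unspent (solvent b t))) K*2^W≤q^C ⟩
    U * q ^ C         ≤⟨ U*q^C≤2*2^W ⟩
    2ℚ * 2ℚ ^ W       ∎)
    where
    open ≤-Reasoning
    U = unspent (ledger b t)
    C = hits b t
    W = misses b t
    U*q^C≤2*2^W : U * q ^ C ≤ 2ℚ * 2ℚ ^ W
    U*q^C≤2*2^W = *-cancelʳ-≤ d 0<d (begin
      U * q ^ C * d                 ≡⟨ solve 3 (λ u x d → u :* x :* d := u :* (d :* x)) refl U (q ^ C) d ⟩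
      U * (d * q ^ C)               ≤⟨ potential b t ⟩
      2ℚ ^ W * budget (ledger b t)  ≤⟨ *-monoˡ-≤ (2ℚ ^ W) (^-nonNeg W (<⇒≤ 0<2)) (budget≤2d (solvent b t)) ⟩
      2ℚ ^ W * (d + d)              ≡⟨ solve 2 (λ y d → y :* (d :+ d) := con 2ℚ :* y :* d) refl (2ℚ ^ W) d ⟩
      2ℚ * 2ℚ ^ W * d               ∎)

  bet-nonNeg : ∀ b i z → 0ℚ ≤ bet b i z
  bet-nonNeg b i z with z xor guess b i
  ... | true  = ≤-refl
  ... | false = <⇒≤ (0<stake (solvent b i))

  bets-total : ∀ b i → bet b i false + bet b i true ≡ stake (ledger b i)
  bets-total b i with guess b i
  ... | true  = +-identityˡ _
  ... | false = +-identityʳ _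

  staked-total : ∀ b t → sumℚ t (λ i → bet b i false + bet b i true) ≡ wrong (ledger b t) + right (ledger b t)
  staked-total b zero    = sym (+-identityʳ 0ℚ)
  staked-total b (suc t) = trans (cong₂ _+_ (staked-total b t) (bets-total b t))
                                 (sym (staked-settle (mistake b t) (ledger b t)))

  ledger-cong : ∀ {b b′} t → AgreeBelow t b b′ → ledger b t ≡ ledger b′ t
  ledger-cong zero    _     = refl
  ledger-cong (suc t) agree =
    cong₂ settle (cong₂ _xor_ (agree t ℕ.≤-refl) (guess-cong t agree′)) (ledger-cong t agree′)
    where agree′ = agreeBelow-pred agree

  bet-causal : ∀ b b′ i z → AgreeBelow i b b′ → bet b i z ≡ bet b′ i z
  bet-causal b b′ i z agree =
    cong₂ (λ g ℓ → if z xor g then 0ℚ else stake ℓ) (guess-cong i agree) (ledger-cong i agree)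

  strategy : Strategy
  strategy = record
    { prob    = bet
    ; nonneg  = bet-nonNeg
    ; total≤1 = λ b t → subst (_≤ 1ℚ) (sym (staked-total b t)) (staked≤1 (solvent b t))
    ; causal  = bet-causal
    }

  succPartial≡right : ∀ b t → succPartial strategy b t ≡ right (ledger b t)
  succPartial≡right b zero = refl
  succPartial≡right b (suc t) with mistake b t
  ... | true  = trans (cong (_+ 0ℚ) (succPartial≡right b t)) (+-identityʳ _)
  ... | false = cong (_+ stake (ledger b t)) (succPartial≡right b t)

  errPartial≡wrong : ∀ b t → errPartial strategy b t ≡ wrong (ledger b t)
  errPartial≡wrong b zero = refl
  errPartial≡wrong b (suc t) with b t | guess b t
  ... | true  | true  = trans (cong (_+ 0ℚ) (errPartial≡wrong b t)) (+-identityʳ _)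
  ... | false | false = trans (cong (_+ 0ℚ) (errPartial≡wrong b t)) (+-identityʳ _)
  ... | true  | false = cong (_+ stake (ledger b t)) (errPartial≡wrong b t)
  ... | false | true  = cong (_+ stake (ledger b t)) (errPartial≡wrong b t)

  errPartial≤2d : ∀ x N → errPartial strategy x N ≤ d + d
  errPartial≤2d x N = subst (_≤ d + d) (sym (errPartial≡wrong x N)) (wrong≤2d (solvent x N))

  succPartial≥1-2d-r : ∀ b t {K r} → 0ℚ < K → 2ℚ ≤ r * K → K * 2ℚ ^ misses b t ≤ q ^ hits b t →
                       1ℚ - (d + d) - r ≤ succPartial strategy b t
  succPartial≥1-2d-r b t {K} {r} 0<K 2≤r*K K*2^W≤q^C = begin
    1ℚ - (d + d) - r          ≤⟨ +-mono-≤ (+-monoʳ-≤ 1ℚ (neg-antimono-≤ (wrong≤2d (solvent b t))))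
                                         (neg-antimono-≤ unspent≤r) ⟩
    1ℚ - wrong ℓ - unspent ℓ  ≡⟨ solve 2 (λ w r → con 1ℚ :- w :- (con 1ℚ :- w :- r) := r) refl (wrong ℓ) (right ℓ) ⟩
    right ℓ                   ≡⟨ succPartial≡right b t ⟨
    succPartial strategy b t  ∎
    where
    open ≤-Reasoning
    ℓ = ledger b t
    unspent≤r : unspent ℓ ≤ r
    unspent≤r = *-cancelʳ-≤ K 0<K (≤-trans (unspent*K≤2 b t K K*2^W≤q^C) 2≤r*K)

-- N δ ≥ 1 and d = 1/(4N), so 2d ≤ δ/2; q^M ≥ 2, q^R ≥ K and K δ ≥ 8, so the unspent mass is
-- at most δ/4 once hits ≥ M · misses + R, which the counting lemmas guarantee at every time
-- t ≥ T₀ at which the minority density is below 1/L.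
module Parameters (δ : ℚ) (0<δ : 0ℚ < δ) where

  N D M K R L T₀ : ℕ
  N  = ↧ₙ δ
  D  = 4 ℕ.* N
  M  = 2 ℕ.* D
  K  = 8 ℕ.* N
  R  = M ℕ.* K
  L  = 4 ℕ.* suc M
  T₀ = 2 ℕ.* (suc M ℕ.+ R)

  d : ℚ
  d = 1/ fromℕ D

  0<d : 0ℚ < d
  0<d = *<* (ℤ.+<+ (ℕ.s≤s ℕ.z≤n))

  d≤1 : d ≤ 1ℚ
  d≤1 = *≤* (ℤ.+≤+ (ℕ.s≤s ℕ.z≤n))

  open MajorityBetting d 0<d d≤1 public

  η : ℚ
  η = δ * ½ * ½

  0<η : 0ℚ < η
  0<η = *-pos (*-pos 0<δ 0<½) 0<½

  4d≤δ : fromℕ 4 * d ≤ δ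
  4d≤δ = *-cancelʳ-≤ (fromℕ N) (*<* (ℤ.+<+ (ℕ.s≤s ℕ.z≤n))) (begin
    fromℕ 4 * d * fromℕ N  ≡⟨ xy∙z≈xz∙y (fromℕ 4) d (fromℕ N) ⟩
    fromℕ 4 * fromℕ N * d  ≡⟨ cong (_* d) (fromℕ-* 4 N) ⟨
    fromℕ D * d            ≡⟨ *-inverseʳ (fromℕ D) ⟩
    1ℚ                     ≤⟨ 1≤↧*p 0<δ ⟩
    fromℕ N * δ            ≡⟨ *-comm (fromℕ N) δ ⟩
    δ * fromℕ N            ∎)
    where open ≤-Reasoning

  2d≤δ : d + d ≤ δ
  2d≤δ = ≤-trans (≤-via-gap (d + d) (solve 1 (λ d → d :+ d :+ (d :+ d) := con (fromℕ 4) :* d) refl d)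
                            (+-nonNeg (<⇒≤ 0<d) (<⇒≤ 0<d)))
                 4d≤δ

  2≤η*K : 2ℚ ≤ η * fromℕ K
  2≤η*K = begin
    2ℚ                       ≡⟨ *-identityʳ 2ℚ ⟨
    2ℚ * 1ℚ                  ≤⟨ *-monoˡ-≤ 2ℚ (<⇒≤ 0<2) (1≤↧*p 0<δ) ⟩
    2ℚ * (fromℕ N * δ)       ≡⟨ solve 2 (λ n δ → con 2ℚ :* (n :* δ) := δ :* con ½ :* con ½ :* (con (fromℕ 8) :* n))
                                       refl (fromℕ N) δ ⟩
    η * (fromℕ 8 * fromℕ N)  ≡⟨ cong (η *_) (fromℕ-* 8 N) ⟨
    η * fromℕ K              ∎
    where open ≤-Reasoning

  1+n≤q^[M*n] : ∀ n → 1ℚ + fromℕ n ≤ q ^ (M ℕ.* n)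
  1+n≤q^[M*n] n = subst (_≤ q ^ (M ℕ.* n)) (cong (λ x → 1ℚ + x) M*n*d/2≡n)
                        (bernoulli (M ℕ.* n) (*-nonNeg (<⇒≤ 0<d) (<⇒≤ 0<½)))
    where
    open ≡-Reasoning
    M*n*d/2≡n : fromℕ (M ℕ.* n) * (d * ½) ≡ fromℕ n
    M*n*d/2≡n = begin
      fromℕ (M ℕ.* n) * (d * ½)              ≡⟨ cong (_* (d * ½)) (trans (fromℕ-* M n) (cong (_* fromℕ n) (fromℕ-* 2 D))) ⟩
      fromℕ 2 * fromℕ D * fromℕ n * (d * ½)  ≡⟨ solve 3 (λ D d n → con (fromℕ 2) :* D :* n :* (d :* con ½) := D :* d :* n)
                                                       refl (fromℕ D) d (fromℕ n) ⟩
      fromℕ D * d * fromℕ n                  ≡⟨ cong (_* fromℕ n) (*-inverseʳ (fromℕ D)) ⟩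
      1ℚ * fromℕ n                           ≡⟨ *-identityˡ (fromℕ n) ⟩
      fromℕ n                                ∎

  K*2^W≤q^C : ∀ {W C} → M ℕ.* W ℕ.+ R ℕ.≤ C → fromℕ K * 2ℚ ^ W ≤ q ^ C
  K*2^W≤q^C {W} {C} MW+R≤C = begin
    fromℕ K * 2ℚ ^ W       ≤⟨ *-monoʳ-≤ (2ℚ ^ W) (^-nonNeg W (<⇒≤ 0<2)) K≤q^R ⟩
    q ^ R * 2ℚ ^ W         ≤⟨ *-monoˡ-≤ (q ^ R) (^-nonNeg R 0≤q) (^-monoˡ-≤ W (<⇒≤ 0<2) 2≤q^M) ⟩
    q ^ R * (q ^ M) ^ W    ≡⟨ cong (q ^ R *_) (^-assocʳ q M W) ⟩
    q ^ R * q ^ (M ℕ.* W)  ≡⟨ ^-homo-* q R (M ℕ.* W) ⟨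
    q ^ (R ℕ.+ M ℕ.* W)    ≤⟨ ^-monoʳ-≤ 1≤q (subst (ℕ._≤ C) (ℕ.+-comm (M ℕ.* W) R) MW+R≤C) ⟩
    q ^ C                  ∎
    where
    open ≤-Reasoning
    K≤q^R : fromℕ K ≤ q ^ R
    K≤q^R = ≤-trans (≤-via-gap 1ℚ (+-comm (fromℕ K) 1ℚ) 0≤1) (1+n≤q^[M*n] K)
    2≤q^M : 2ℚ ≤ q ^ M
    2≤q^M = subst (2ℚ ≤_) (cong (q ^_) (ℕ.*-identityʳ M)) (1+n≤q^[M*n] 1)

  success-at : ∀ b t o → misses b t ℕ.≤ 2 ℕ.* o ℕ.+ 1 → o ℕ.* L ℕ.< t → T₀ ℕ.≤ t →
               1ℚ - δ + η ≤ succPartial strategy b t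
  success-at b t o W≤ sparse long = ≤-trans margin
    (succPartial≥1-2d-r b t (*<* (ℤ.+<+ (ℕ.s≤s ℕ.z≤n))) 2≤η*K
      (K*2^W≤q^C (hits-dominate M R o b t W≤ sparse long)))
    where
    margin : 1ℚ - δ + η ≤ 1ℚ - (d + d) - η
    margin = ≤-via-gap ((δ - fromℕ 4 * d) * ½)
      (solve 2 (λ δ d → con 1ℚ :- δ :+ δ :* con ½ :* con ½ :+ (δ :- con (fromℕ 4) :* d) :* con ½
                      := con 1ℚ :- (d :+ d) :- δ :* con ½ :* con ½)
             refl δ d)
      (*-nonNeg (0≤q-p 4d≤δ) (<⇒≤ 0<½))

  success-on : ∀ b f → (∀ t → misses b t ℕ.≤ 2 ℕ.* ones f t ℕ.+ 1) → WeaklySparse f →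
               ∃[ t ] (1ℚ - δ + η ≤ succPartial strategy b t)
  success-on b f misses≤ sparse
    with s₀ , sparse-after ← sparse (1/ fromℕ L) (*<* (ℤ.+<+ (ℕ.s≤s ℕ.z≤n)))
    with k , s₀+T₀≤1+k , density<1/L ← sparse-after (s₀ ℕ.+ T₀) (ℕ.m≤m+n s₀ T₀) =
    suc k , success-at b (suc k) (ones f (suc k)) (misses≤ (suc k))
              (density<1/ (ones f (suc k)) k L density<1/L) (ℕ.≤-trans (ℕ.m≤n+m T₀ s₀) s₀+T₀≤1+k)

lemma6 : (δ : ℚ) → 0ℚ < δ →
    Σ[ P ∈ Strategy ]
    (SuccGreater P (λ b → A-ws b ⊎ A-co-ws b) (1ℚ - δ)
    × (∀ x → ErrorAtMost P x δ))
lemma6 δ 0<δ = strategy , (η , 0<η , succeeds) , λ x N → ≤-trans (errPartial≤2d x N) 2d≤δ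
  where
  open Parameters δ 0<δ
  succeeds : ∀ b → A-ws b ⊎ A-co-ws b → ∃[ N ] (1ℚ - δ + η ≤ succPartial strategy b N)
  succeeds b (inj₁ sparse)    = success-on b b (misses≤2*ones+1 b) sparse
  succeeds b (inj₂ co-sparse) = success-on b (neg b) (misses≤2*zeros+1 b) co-sparse
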